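{- Let $T$ be an order tree. If $G$ is a $T$-graph of finite adhesion, then every branch (maximal chain) of $T$ is countable.
   Context: An order tree is a poset $(T,\le)$ with a unique minimal element in which every $\lceil t\rceil=\{t'\le t\}$ is well-ordered; $\mathring{\lceil t\rceil}=\lceil t\rceil\setminus\{t\}$. The height of $t$ is the order type of $\mathring{\lceil t\rceil}$; $T^{\le\sigma}$ is the set of points of height at most $\sigma$. A graph $G$ is a $T$-graph if $V(G)=T$, endvertices of every edge are comparable in $T$, and for each $t$ the set of neighbours of $t$ below $t$ is cofinal in $\mathring{\lceil t\rceil}$. A $T$-graph has finite adhesion if for every limit ordinal $\sigma$ every component of $G-T^{\le\sigma}$ has finite neighbourhood. -}

module Defs where

open import Level using (Level; _⊔_) renaming (suc to lsuc)
open import Data.Nat using (ℕ)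
open import Data.Product using (Σ; ∃; _×_; proj₁)
open import Data.Sum using (_⊎_)
open import Data.List using (List)
open import Data.List.Membership.Propositional using (_∈_)
open import Relation.Binary.Structures using (IsPartialOrder)
open import Relation.Binary.PropositionalEquality using (_≡_; _≢_)
open import Relation.Nullary using (¬_)

Minimal : ∀ {ℓ} {A : Set ℓ} → (A → A → Set ℓ) → A → Set ℓ
Minimal _≤_ r = ∀ s → s ≤ r → s ≡ r

WellOrderedOn : ∀ {ℓ} {A : Set ℓ} → (A → A → Set ℓ) → (A → Set ℓ) → Set (lsuc ℓ)
WellOrderedOn {ℓ} {A} _≤_ P =
  (Q : A → Set ℓ) → (∃ λ x → P x × Q x) →
  ∃ λ m → P m × Q m × (∀ y → P y → Q y → m ≤ y)

record OrderTree (ℓ : Level) : Set (lsuc ℓ) where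
  field
    Carrier        : Set ℓ
    _≤_            : Carrier → Carrier → Set ℓ
    isPartialOrder : IsPartialOrder _≡_ _≤_
    uniqueMinimal  : Σ Carrier λ r → Minimal _≤_ r × (∀ m → Minimal _≤_ m → m ≡ r)
    downWellOrdered : ∀ t → WellOrderedOn _≤_ (λ s → s ≤ t)

  _<_ : Carrier → Carrier → Set ℓ
  s < t = s ≤ t × s ≢ t

  Down : Carrier → Set ℓ
  Down t = Σ Carrier λ s → s < t

-- A well-ordered set, representing an ordinal (its order type)
record WellOrder (ℓ : Level) : Set (lsuc ℓ) where
  field
    Carrier        : Set ℓ
    _⊑_            : Carrier → Carrier → Set ℓ
    isPartialOrder : IsPartialOrder _≡_ _⊑_
    wellOrdered    : (Q : Carrier → Set ℓ) → (∃ λ x → Q x) →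
                     ∃ λ m → Q m × (∀ y → Q y → m ⊑ y)

IsLimit : ∀ {ℓ} → WellOrder ℓ → Set ℓ
IsLimit W = Carrier × (∀ w → ∃ λ w' → w ⊑ w' × w ≢ w')
  where open WellOrder W

module _ {ℓ} (T : OrderTree ℓ) where
  open OrderTree T

  -- height(t) ≤ σ, where σ is the order type of W: the well-order ⌈t⌉̊ embeds
  -- as an initial segment (order-isomorphically onto a down-closed subset) into W
  HeightAtMost : Carrier → WellOrder ℓ → Set ℓ
  HeightAtMost t W =
    ∃ λ (f : Down t → WellOrder.Carrier W) →
      (∀ x y → (proj₁ x ≤ proj₁ y → WellOrder._⊑_ W (f x) (f y))
             × (WellOrder._⊑_ W (f x) (f y) → proj₁ x ≤ proj₁ y))
      × (∀ x w → WellOrder._⊑_ W w (f x) → ∃ λ y → f y ≡ w)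

  record TGraph : Set (lsuc ℓ) where
    field
      Adj      : Carrier → Carrier → Set ℓ
      sym      : ∀ {s t} → Adj s t → Adj t s
      irrefl   : ∀ {t} → ¬ Adj t t
      comparable : ∀ {s t} → Adj s t → s ≤ t ⊎ t ≤ s
      cofinal  : ∀ t s → s < t → ∃ λ u → s ≤ u × u < t × Adj u t

    -- vertices reachable from v by a path in G - X (the component of G - X containing v)
    data Reach (X : Carrier → Set ℓ) (v : Carrier) : Carrier → Set ℓ where
      here : ¬ X v → Reach X v v
      step : ∀ {u w} → Reach X v u → Adj u w → ¬ X w → Reach X v w

    Nbhd : (Carrier → Set ℓ) → Carrier → Set ℓ
    Nbhd C u = ¬ C u × ∃ λ w → C w × Adj w u

    FiniteSet : (Carrier → Set ℓ) → Set ℓ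
    FiniteSet P = ∃ λ (xs : List Carrier) → ∀ u → P u → u ∈ xs

    -- finite adhesion: for every limit ordinal σ, every component of G - T^{≤σ}
    -- has finite neighbourhood (components = Reach X v for v ∉ X)
    FiniteAdhesion : Set (lsuc ℓ)
    FiniteAdhesion =
      (W : WellOrder ℓ) → IsLimit W →
      let X = λ t → HeightAtMost t W in
      ∀ v → ¬ X v → FiniteSet (Nbhd (Reach X v))

  IsChain : (Carrier → Set ℓ) → Set ℓ
  IsChain B = ∀ x y → B x → B y → x ≤ y ⊎ y ≤ x

  IsBranch : (Carrier → Set ℓ) → Set (lsuc ℓ)
  IsBranch B = IsChain B × (∀ (C : Carrier → Set ℓ) → IsChain C →
                             (∀ x → B x → C x) → ∀ x → C x → B x)

  Countable : (Carrier → Set ℓ) → Set ℓ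
  Countable B = ∃ λ (f : Σ Carrier B → ℕ) → ∀ x y → f x ≡ f y → proj₁ x ≡ proj₁ y

-- Let B be a branch and suppose some initial segment I of B without a largest
-- element had uncountable cofinality. Then every ω-sequence in I is bounded in I, so
-- every increasing ω-sequence has a supremum in I, which is a limit point μ. Finite
-- adhesion applied to the component of G − T^{≤ height μ} containing the branch above
-- μ bounds all edges from there to ⌈μ⌉̊ by some γ(μ) < μ. A pressing-down argument
-- gives one γ bounding the crossings of cofinally many limits μ_n; at their supremum
-- the neighbours cofinal below it give an edge whose lower end lies above γ, which is
-- absurd. Hence every initial segment of B is a countable union of countable sets, by
-- well-founded induction along B.

module Submission where

open import Defs
open import Axiom.ExcludedMiddle using (ExcludedMiddle)
open import Axiom.DoubleNegationElimination using (em⇒dne)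
open import Data.Nat using (ℕ; zero; suc; _+_; z≤n; s≤s) renaming (_≤_ to _≤ℕ_; _<_ to _<ℕ_)
open import Data.Nat.GeneralisedArithmetic using (fold)
import Data.Nat.Properties as ℕ
open import Data.Bool.Properties using (T-irrelevant)
open import Data.Product using (Σ; ∃; _×_; _,_; proj₁; proj₂)
open import Data.Sum using (_⊎_; inj₁; inj₂; [_,_]′; swap; map₂)
open import Data.Empty using (⊥; ⊥-elim)
open import Data.List using (List; []; _∷_)
open import Data.List.Membership.Propositional using (_∈_)
open import Data.List.Relation.Unary.Any using (here; there)
open import Function using (id)
open import Relation.Nullary using (¬_; yes; no)
open import Relation.Nullary.Decidable using (True; toWitness; fromWitness)
open import Relation.Unary using (Pred; _⊆_; _∪_; ⋃; ｛_｝)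
open import Relation.Binary.PropositionalEquality using (_≡_; refl; sym; cong; isEquivalence)
open import Relation.Binary.Structures using (IsPartialOrder)
open import Relation.Binary.Definitions using (tri<; tri≈; tri>)

triangle : ℕ → ℕ
triangle zero    = zero
triangle (suc n) = suc n + triangle n

triangle-mono : ∀ {a b} → a ≤ℕ b → triangle a ≤ℕ triangle b
triangle-mono z≤n       = z≤n
triangle-mono (s≤s a≤b) = s≤s (ℕ.+-mono-≤ a≤b (triangle-mono a≤b))

triangle+<triangle : ∀ {a b k} → k ≤ℕ a → a <ℕ b → triangle a + k <ℕ triangle b
triangle+<triangle {a} {suc b} {k} k≤a (s≤s a≤b) = s≤s (begin
  triangle a + k ≤⟨ ℕ.+-monoʳ-≤ (triangle a) k≤a ⟩
  triangle a + a ≡⟨ ℕ.+-comm (triangle a) a ⟩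
  a + triangle a ≤⟨ ℕ.+-mono-≤ a≤b (triangle-mono a≤b) ⟩
  b + triangle b ∎)
  where open ℕ.≤-Reasoning

triangle+-injective : ∀ {a b k l} → k ≤ℕ a → l ≤ℕ b →
                      triangle a + k ≡ triangle b + l → a ≡ b × k ≡ l
triangle+-injective {a} {b} {k} {l} k≤a l≤b eq with ℕ.<-cmp a b
... | tri< a<b _ _ =
  ⊥-elim (ℕ.<-irrefl eq (ℕ.<-≤-trans (triangle+<triangle k≤a a<b) (ℕ.m≤m+n _ l)))
... | tri> _ _ b<a =
  ⊥-elim (ℕ.<-irrefl (sym eq) (ℕ.<-≤-trans (triangle+<triangle l≤b b<a) (ℕ.m≤m+n _ k)))
... | tri≈ _ refl _ = refl , ℕ.+-cancelˡ-≡ (triangle a) k l eq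

pair : ℕ → ℕ → ℕ
pair m n = triangle (m + n) + m

pair-injective : ∀ {m n m′ n′} → pair m n ≡ pair m′ n′ → m ≡ m′ × n ≡ n′
pair-injective {m} {n} {m′} {n′} eq
  with triangle+-injective (ℕ.m≤m+n m n) (ℕ.m≤m+n m′ n′) eq
... | m+n≡m′+n′ , refl = refl , ℕ.+-cancelˡ-≡ m n n′ m+n≡m′+n′

module _ {a} {A : Set a} where

  IsCountable : Pred A a → Set a
  IsCountable P = ∃ λ (f : Σ A P → ℕ) → ∀ x y → f x ≡ f y → proj₁ x ≡ proj₁ y

  countable-⊆ : {P Q : Pred A a} → P ⊆ Q → IsCountable Q → IsCountable P
  countable-⊆ P⊆Q (f , f-injective) =
    (λ (x , p) → f (x , P⊆Q p)) , λ (x , p) (y , q) → f-injective (x , P⊆Q p) (y , P⊆Q q)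

  countable-empty : {P : Pred A a} → (∀ x → ¬ P x) → IsCountable P
  countable-empty P-empty = (λ _ → 0) , λ (x , p) _ _ → ⊥-elim (P-empty x p)

  countable-｛｝ : (x : A) → IsCountable ｛ x ｝
  countable-｛｝ x = (λ _ → 0) , λ { (_ , refl) (_ , refl) _ → refl }

  countable-⋃ : (P : ℕ → Pred A a) → (∀ n → IsCountable (P n)) → IsCountable (⋃ ℕ P)
  countable-⋃ P P-countable = code , code-injective
    where
    code : Σ A (⋃ ℕ P) → ℕ
    code (x , n , p) = pair n (proj₁ (P-countable n) (x , p))

    code-injective : ∀ u v → code u ≡ code v → proj₁ u ≡ proj₁ v
    code-injective (x , n , p) (y , m , q) eq with pair-injective {n} {_} {m} eq
    ... | refl , eq′ = proj₂ (P-countable n) (x , p) (y , q) eq′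

  countable-∪ : {P Q : Pred A a} → IsCountable P → IsCountable Q → IsCountable (P ∪ Q)
  countable-∪ {P} {Q} P-countable Q-countable = countable-⊆ split (countable-⋃ R R-countable)
    where
    R : ℕ → Pred A a
    R zero    = P
    R (suc _) = Q

    R-countable : ∀ n → IsCountable (R n)
    R-countable zero    = P-countable
    R-countable (suc _) = Q-countable

    split : P ∪ Q ⊆ ⋃ ℕ R
    split (inj₁ p) = 0 , p
    split (inj₂ q) = 1 , q

module _ {ℓ} (T : OrderTree ℓ) where
  open OrderTree T
  open IsPartialOrder isPartialOrder using ()
    renaming (refl to ≤-refl; reflexive to ≤-reflexive; trans to ≤-trans; antisym to ≤-antisym)

  ≤-<-trans : ∀ {x y z} → x ≤ y → y < z → x < z
  ≤-<-trans x≤y (y≤z , y≢z) = ≤-trans x≤y y≤z , λ { refl → y≢z (≤-antisym y≤z x≤y) }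

  <-≤-trans : ∀ {x y z} → x < y → y ≤ z → x < z
  <-≤-trans (x≤y , x≢y) y≤z = ≤-trans x≤y y≤z , λ { refl → x≢y (≤-antisym x≤y y≤z) }

  <⇒≱ : ∀ {x y} → x < y → ¬ y ≤ x
  <⇒≱ (x≤y , x≢y) y≤x = x≢y (≤-antisym x≤y y≤x)

  ≤-total-below : ∀ {s s′ t} → s ≤ t → s′ ≤ t → s ≤ s′ ⊎ s′ ≤ s
  ≤-total-below {s} {s′} {t} s≤t s′≤t
    with downWellOrdered t (λ x → x ≡ s ⊎ x ≡ s′) (s , s≤t , inj₁ refl)
  ... | _ , _ , inj₁ refl , least = inj₁ (least s′ s′≤t (inj₂ refl))
  ... | _ , _ , inj₂ refl , least = inj₂ (least s s≤t (inj₁ refl))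

  IsLimitPoint : Carrier → Set ℓ
  IsLimitPoint μ = Down μ × (∀ {y} → y < μ → ∃ λ z → y < z × z < μ)

  module _ (em : ExcludedMiddle ℓ) where

    byContradiction : {P : Set ℓ} → ¬ ¬ P → P
    byContradiction = em⇒dne em

    ¬∀⇒∃¬ : {A : Set ℓ} {P : Pred A ℓ} → ¬ (∀ x → P x) → ∃ λ x → ¬ P x
    ¬∀⇒∃¬ ¬all = byContradiction λ ¬ex → ¬all λ x → byContradiction λ ¬px → ¬ex (x , ¬px)

    ≤⇒<⊎≡ : ∀ {x y} → x ≤ y → x < y ⊎ x ≡ y
    ≤⇒<⊎≡ {x} {y} x≤y with em {x ≡ y}
    ... | yes x≡y = inj₂ x≡y
    ... | no x≢y  = inj₁ (x≤y , x≢y)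

    <-wfInduction : (P : Pred Carrier ℓ) → (∀ t → (∀ s → s < t → P s) → P t) → ∀ t → P t
    <-wfInduction P step t = byContradiction λ ¬Pt →
      let m , m≤t , ¬Pm , least = downWellOrdered t (λ s → ¬ P s) (t , ≤-refl , ¬Pt)
      in ¬Pm (step m λ s s<m → byContradiction λ ¬Ps →
                <⇒≱ s<m (least s (≤-trans (proj₁ s<m) m≤t) ¬Ps))

    finite-boundedBelow : ∀ {μ} → Down μ → (xs : List Carrier) →
                          ∃ λ γ → γ < μ × (∀ {a} → a ∈ xs → a < μ → a ≤ γ)
    finite-boundedBelow (y , y<μ) [] = y , y<μ , λ ()
    finite-boundedBelow {μ} y (x ∷ xs) with finite-boundedBelow y xs | em {x < μ}
    ... | γ , γ<μ , bound | no x≮μ =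
      γ , γ<μ , λ { (here refl) x<μ → ⊥-elim (x≮μ x<μ) ; (there a∈xs) → bound a∈xs }
    ... | γ , γ<μ , bound | yes x<μ with ≤-total-below (proj₁ x<μ) (proj₁ γ<μ)
    ...   | inj₁ x≤γ = γ , γ<μ , λ { (here refl) _ → x≤γ ; (there a∈xs) → bound a∈xs }
    ...   | inj₂ γ≤x = x , x<μ , λ { (here refl) _ → ≤-refl
                                    ; (there a∈xs) a<μ → ≤-trans (bound a∈xs a<μ) γ≤x }

    -- ⌈μ⌉̊ as a well-order; membership is `True (em …)` rather than `s < μ` so that it
    -- is proof-irrelevant, as antisymmetry up to _≡_ requires.
    Below : Carrier → Set ℓ
    Below μ = Σ Carrier λ s → True (em {s < μ})

    Below-≡ : ∀ {μ} {x y : Below μ} → proj₁ x ≡ proj₁ y → x ≡ y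
    Below-≡ {x = s , p} {.s , q} refl = cong (s ,_) (T-irrelevant p q)

    below : ∀ {s μ} → s < μ → Below μ
    below s<μ = _ , fromWitness s<μ

    below-< : ∀ {μ} (x : Below μ) → proj₁ x < μ
    below-< (_ , p) = toWitness p

    initialSegment : Carrier → WellOrder ℓ
    initialSegment μ = record
      { Carrier        = Below μ
      ; _⊑_            = λ x y → proj₁ x ≤ proj₁ y
      ; isPartialOrder = record
        { isPreorder = record
          { isEquivalence = isEquivalence
          ; reflexive     = λ { refl → ≤-refl }
          ; trans         = ≤-trans
          }
        ; antisym = λ x≤y y≤x → Below-≡ (≤-antisym x≤y y≤x)
        }
      ; wellOrdered    = least
      }
      where
      least : (Q : Below μ → Set ℓ) → Σ (Below μ) Q →
              ∃ λ m → Q m × (∀ y → Q y → proj₁ m ≤ proj₁ y)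
      least Q ((s , p) , Qs) =
        let m , _ , (pm , Qm) , m-least =
              downWellOrdered μ (λ t → Σ (True (em {t < μ})) λ p → Q (t , p))
                              (s , proj₁ (toWitness p) , p , Qs)
        in (m , pm) , Qm , λ y Qy → m-least (proj₁ y) (proj₁ (below-< y)) (proj₂ y , Qy)

    initialSegment-isLimit : ∀ {μ} → IsLimitPoint μ → IsLimit (initialSegment μ)
    initialSegment-isLimit ((y , y<μ) , dense) =
      below y<μ , λ x → let z , x<z , z<μ = dense (below-< x)
                        in below z<μ , proj₁ x<z , λ x≡z → proj₂ x<z (cong proj₁ x≡z)

    HeightAtMostOf : Carrier → Pred Carrier ℓ
    HeightAtMostOf μ v = HeightAtMost T v (initialSegment μ)

    height≤-if-≤ : ∀ {v μ} → v ≤ μ → HeightAtMostOf μ v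
    height≤-if-≤ v≤μ =
      (λ (s , s<v) → below (<-≤-trans s<v v≤μ)) ,
      (λ _ _ → id , id) ,
      λ (s , s<v) w w≤s → (proj₁ w , ≤-<-trans w≤s s<v) , Below-≡ refl

    -- An order embedding of the well-order ⌈v⌉̊ into its proper initial segment ⌈μ⌉̊
    -- would move some point down; the least such point s yields f(f s) < f s.
    height≰-if-> : ∀ {v μ} → μ < v → ¬ HeightAtMostOf μ v
    height≰-if-> {v} {μ} μ<v (f , f-embedding , _) =
      let m , _ , (m<v , fm<m) , m-least =
            downWellOrdered v (λ s → Σ (s < v) λ s<v → proj₁ (f (s , s<v)) < s)
                            (μ , proj₁ μ<v , μ<v , below-< (f (μ , μ<v)))
          t   = proj₁ (f (m , m<v))
          t<v = <-≤-trans fm<m (proj₁ m<v)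
          ft≤t = proj₁ (f-embedding (t , t<v) (m , m<v)) (proj₁ fm<m)
          ft≢t = λ ft≡t → <⇒≱ fm<m
                   (proj₂ (f-embedding (m , m<v) (t , t<v)) (≤-reflexive (sym ft≡t)))
      in <⇒≱ fm<m (m-least t (proj₁ t<v) (t<v , ft≤t , ft≢t))

    module _ (G : TGraph T) where
      open TGraph G

      reach-avoids : ∀ {X v u} → Reach X v u → ¬ X u
      reach-avoids (here v∉X)     = v∉X
      reach-avoids (step _ _ u∉X) = u∉X

      reach-above : ∀ {μ v} → μ < v → ∀ w → v ≤ w → Reach (HeightAtMostOf μ) v w
      reach-above {μ} {v} μ<v = <-wfInduction (λ w → v ≤ w → Reach (HeightAtMostOf μ) v w) ind
        where
        ind : ∀ w → (∀ u → u < w → v ≤ u → Reach (HeightAtMostOf μ) v u) →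
              v ≤ w → Reach (HeightAtMostOf μ) v w
        ind w ih v≤w with ≤⇒<⊎≡ v≤w
        ... | inj₂ refl = here (height≰-if-> μ<v)
        ... | inj₁ v<w with cofinal w v v<w
        ... | u , v≤u , u<w , u~w =
          step (ih u u<w v≤u) u~w (height≰-if-> (<-≤-trans μ<v v≤w))

    module _ {B : Pred Carrier ℓ} (B-branch : IsBranch T B) where

      branch-absorbs : ∀ {x} → (∀ {y} → B y → x ≤ y ⊎ y ≤ x) → B x
      branch-absorbs {x} comparable = proj₂ B-branch (B ∪ ｛ x ｝) chain (λ _ → inj₁) x (inj₂ refl)
        where
        chain : IsChain T (B ∪ ｛ x ｝)
        chain y z (inj₁ By) (inj₁ Bz)  = proj₁ B-branch y z By Bz
        chain y _ (inj₁ By) (inj₂ refl) = swap (comparable By)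
        chain _ z (inj₂ refl) (inj₁ Bz) = comparable Bz
        chain _ _ (inj₂ refl) (inj₂ refl) = inj₁ ≤-refl

      branch-downClosed : ∀ {x w} → x ≤ w → B w → B x
      branch-downClosed {x} {w} x≤w Bw = branch-absorbs comparable
        where
        comparable : ∀ {y} → B y → x ≤ y ⊎ y ≤ x
        comparable {y} By with proj₁ B-branch y w By Bw
        ... | inj₁ y≤w = swap (≤-total-below y≤w x≤w)
        ... | inj₂ w≤y = inj₁ (≤-trans x≤w w≤y)

      branch-compare : ∀ {x y} → B x → B y → x < y ⊎ y ≤ x
      branch-compare {x} {y} Bx By with proj₁ B-branch x y Bx By
      ... | inj₂ y≤x = inj₂ y≤x
      ... | inj₁ x≤y with ≤⇒<⊎≡ x≤y
      ...   | inj₁ x<y  = inj₁ x<y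
      ...   | inj₂ refl = inj₂ ≤-refl

      branch-≮⇒≥ : ∀ {x y} → B x → B y → ¬ x < y → y ≤ x
      branch-≮⇒≥ Bx By x≮y with branch-compare Bx By
      ... | inj₁ x<y = ⊥-elim (x≮y x<y)
      ... | inj₂ y≤x = y≤x

      branch-≰⇒> : ∀ {x y} → B x → B y → ¬ y ≤ x → x < y
      branch-≰⇒> Bx By y≰x with branch-compare Bx By
      ... | inj₁ x<y = x<y
      ... | inj₂ y≤x = ⊥-elim (y≰x y≤x)

      branch-least : (Q : Pred Carrier ℓ) → Q ⊆ B → ∃ Q → ∃ λ m → Q m × (∀ {y} → Q y → m ≤ y)
      branch-least Q Q⊆B (x , Qx) =
        let m , m≤x , Qm , least = downWellOrdered x Q (x , ≤-refl , Qx)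
        in m , Qm , λ {y} Qy → [ (λ y≤x → least y y≤x Qy) , (λ x≤y → ≤-trans m≤x x≤y) ]′
                                 (proj₁ B-branch y x (Q⊆B Qy) (Q⊆B Qx))

      noMaximum⇒unbounded : {I : Pred Carrier ℓ} → I ⊆ B → ¬ (∃ λ p → I p × I ⊆ (_≤ p)) →
                            ∀ {x} → I x → ∃ λ y → I y × x < y
      noMaximum⇒unbounded {I} I⊆B no-maximum {x} Ix = byContradiction λ ¬above →
        no-maximum (x , Ix , λ Iz → branch-≮⇒≥ (I⊆B Ix) (I⊆B Iz) λ x<z → ¬above (_ , Iz , x<z))

      module _ (G : TGraph T) (adhesion : TGraph.FiniteAdhesion G) where
        open TGraph G renaming (sym to Adj-sym)

        CrossingsBoundedBy : Carrier → Carrier → Set ℓ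
        CrossingsBoundedBy μ γ = ∀ {l a} → B l → μ < l → Adj a l → a < μ → a ≤ γ

        crossingsBoundedBy-mono : ∀ {μ γ γ′} → γ ≤ γ′ →
                                  CrossingsBoundedBy μ γ → CrossingsBoundedBy μ γ′
        crossingsBoundedBy-mono γ≤γ′ bounded Bl μ<l a~l a<μ = ≤-trans (bounded Bl μ<l a~l a<μ) γ≤γ′

        -- The branch above μ lies in one component of G − T^{≤ height μ}, that of the
        -- least branch point v above μ; its finite neighbourhood contains the lower ends.
        limit-crossingsBounded : ∀ {μ} → IsLimitPoint μ → (∃ λ x → B x × μ < x) →
                                 ∃ λ γ → γ < μ × CrossingsBoundedBy μ γ
        limit-crossingsBounded {μ} μ-limit B-above =
          let v , (_ , μ<v) , v-least = branch-least (λ x → B x × μ < x) proj₁ B-above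
              xs , xs-covers = adhesion (initialSegment μ) (initialSegment-isLimit μ-limit)
                                        v (height≰-if-> μ<v)
              γ , γ<μ , bound = finite-boundedBelow (proj₁ μ-limit) xs
          in γ , γ<μ , λ {l} {a} Bl μ<l a~l a<μ →
               bound (xs-covers a ( (λ r → reach-avoids G r (height≤-if-≤ (proj₁ a<μ)))
                                  , l , reach-above G μ<v l (v-least (Bl , μ<l)) , Adj-sym a~l))
                     a<μ

        module _ {I : Pred Carrier ℓ} (I⊆B : I ⊆ B) (I-downClosed : ∀ {x y} → x ≤ y → I y → I x)
                 (I-inhabited : ∃ I) (I-unbounded : ∀ {x} → I x → ∃ λ y → I y × x < y) where

          Point : Set ℓ
          Point = Σ Carrier I

          CofinalSequence : Set ℓ
          CofinalSequence = ∃ λ (s : ℕ → Point) → ∀ {x} → I x → ∃ λ n → x ≤ proj₁ (s n)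

          record BoundedLimitAbove (γ ν : Carrier) : Set ℓ where
            field
              μ         : Carrier
              μ∈I       : I μ
              μ-limit   : IsLimitPoint μ
              ν<μ       : ν < μ
              μ-bounded : CrossingsBoundedBy μ γ

          BoundsCofinallyMany : Carrier → Set ℓ
          BoundsCofinallyMany γ = (ν : Point) → BoundedLimitAbove γ (proj₁ ν)

          commonStrictUpperBound : (x y : Point) → Σ Point λ z → proj₁ x < proj₁ z × proj₁ y < proj₁ z
          commonStrictUpperBound (x , Ix) (y , Iy) with branch-compare (I⊆B Ix) (I⊆B Iy)
          ... | inj₁ x<y = let z , Iz , y<z = I-unbounded Iy in (z , Iz) , <-≤-trans x<y (proj₁ y<z) , y<z
          ... | inj₂ y≤x = let z , Iz , x<z = I-unbounded Ix in (z , Iz) , x<z , ≤-<-trans y≤x x<z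

          branchAbove : ∀ {x} → I x → ∃ λ y → B y × x < y
          branchAbove Ix = let y , Iy , x<y = I-unbounded Ix in y , I⊆B Iy , x<y

          module UncountableCofinality (¬cofinal : ¬ CofinalSequence) where

            sequence-bounded : (s : ℕ → Point) → ∃ λ x → I x × (∀ n → proj₁ (s n) < x)
            sequence-bounded s = byContradiction λ ¬bounded → ¬cofinal (s , λ {x} Ix →
              byContradiction λ ¬reached → ¬bounded (x , Ix , λ n →
                branch-≰⇒> (I⊆B (proj₂ (s n))) (I⊆B Ix) λ x≤sn → ¬reached (n , x≤sn)))

            record Supremum (s : ℕ → Point) : Set ℓ where
              field
                top       : Carrier
                top∈I     : I top
                top-limit : IsLimitPoint top
                s<top     : ∀ n → proj₁ (s n) < top
                <top⇒<s   : ∀ {y} → y < top → ∃ λ n → y < proj₁ (s n)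

            supremum : (s : ℕ → Point) → (∀ n → proj₁ (s n) < proj₁ (s (suc n))) → Supremum s
            supremum s increasing = record
              { top = m ; top∈I = Im ; s<top = s<m ; <top⇒<s = <m⇒<s
              ; top-limit = (_ , s<m 0) , λ y<m → let n , y<sn = <m⇒<s y<m in _ , y<sn , s<m n
              }
              where
              UpperBound : Pred Carrier ℓ
              UpperBound y = I y × (∀ n → proj₁ (s n) ≤ y)

              least-upperBound : ∃ λ m → UpperBound m × (∀ {y} → UpperBound y → m ≤ y)
              least-upperBound =
                let x , Ix , s<x = sequence-bounded s
                in branch-least UpperBound (λ (Iy , _) → I⊆B Iy) (x , Ix , λ n → proj₁ (s<x n))

              m = proj₁ least-upperBound
              Im = proj₁ (proj₁ (proj₂ least-upperBound))

              s<m : ∀ n → proj₁ (s n) < m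
              s<m n = <-≤-trans (increasing n) (proj₂ (proj₁ (proj₂ least-upperBound)) (suc n))

              <m⇒<s : ∀ {y} → y < m → ∃ λ n → y < proj₁ (s n)
              <m⇒<s {y} y<m = byContradiction λ ¬below →
                let Iy = I-downClosed (proj₁ y<m) Im
                in <⇒≱ y<m (proj₂ (proj₂ least-upperBound)
                             (Iy , λ n → branch-≮⇒≥ (I⊆B Iy) (I⊆B (proj₂ (s n))) λ y<sn → ¬below (n , y<sn)))

            -- Pressing down: otherwise pick for each γ a point beyond which no limit has
            -- crossings bounded by γ, and climb past these points. At the supremum, the bound
            -- γ′ from finite adhesion lies below some term γ, contradicting the choice for γ.
            boundingPoint : ∃ λ γ → I γ × BoundsCofinallyMany γ
            boundingPoint = byContradiction λ none →
              let escape : (γ : Point) → Σ Point λ ν → ¬ BoundedLimitAbove (proj₁ γ) (proj₁ ν)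
                  escape (γ , Iγ) = ¬∀⇒∃¬ λ bounding → none (γ , Iγ , bounding)
                  upper = λ γ → commonStrictUpperBound γ (proj₁ (escape γ))
                  s = fold I-inhabited λ γ → proj₁ (upper γ)
                  open Supremum (supremum s λ n → proj₁ (proj₂ (upper (s n))))
                  γ′ , γ′<top , γ′-bounds = limit-crossingsBounded top-limit (branchAbove top∈I)
                  n , γ′<sn = <top⇒<s γ′<top
              in proj₂ (escape (s n)) record
                   { μ = top ; μ∈I = top∈I ; μ-limit = top-limit
                   ; ν<μ = <-≤-trans (proj₂ (proj₂ (upper (s n)))) (proj₁ (s<top (suc n)))
                   ; μ-bounded = crossingsBoundedBy-mono (proj₁ γ′<sn) γ′-bounds
                   }

            -- Along limits μ₀ < μ₁ < … bounded by γ, the neighbours of their supremum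
            -- cofinal below it include one above γ; it lies below some μₙ, hence is ≤ γ.
            ¬boundsCofinallyMany : ∀ {γ} → I γ → ¬ BoundsCofinallyMany γ
            ¬boundsCofinallyMany {γ} Iγ bounding =
              let a , s₀≤a , a<top , a~top = cofinal top (proj₁ (s 0)) (s<top 0)
                  n , a<sn = <top⇒<s a<top
                  open BoundedLimitAbove (bounding (s n))
              in <⇒≱ (<-≤-trans (next-above (γ , Iγ)) s₀≤a)
                     (μ-bounded (I⊆B top∈I) (s<top (suc n)) a~top (<-≤-trans a<sn (proj₁ ν<μ)))
              where
              next : Point → Point
              next ν = BoundedLimitAbove.μ (bounding ν) , BoundedLimitAbove.μ∈I (bounding ν)

              next-above : ∀ ν → proj₁ ν < proj₁ (next ν)
              next-above ν = BoundedLimitAbove.ν<μ (bounding ν)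

              s : ℕ → Point
              s = fold (next (γ , Iγ)) next

              open Supremum (supremum s λ n → next-above (s n))

            absurd : ⊥
            absurd = let _ , Iγ , bounding = boundingPoint in ¬boundsCofinallyMany Iγ bounding

          cofinalSequence : CofinalSequence
          cofinalSequence = byContradiction UncountableCofinality.absurd

        ⌈⌉-countable : ∀ {x} → IsCountable (_< x) → IsCountable (_≤ x)
        ⌈⌉-countable {x} below-countable =
          countable-⊆ (λ y≤x → map₂ sym (≤⇒<⊎≡ y≤x)) (countable-∪ below-countable (countable-｛｝ x))

        downClosed-countable : {I : Pred Carrier ℓ} → I ⊆ B → (∀ {x y} → x ≤ y → I y → I x) →
                               (∀ {x} → I x → IsCountable (_< x)) → IsCountable I
        downClosed-countable {I} I⊆B I-downClosed below-countable
          with em {∃ λ p → I p × I ⊆ (_≤ p)} | em {∃ I}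
        ... | yes (p , Ip , maximum) | _ = countable-⊆ maximum (⌈⌉-countable (below-countable Ip))
        ... | no _ | no empty = countable-empty λ x Ix → empty (x , Ix)
        ... | no no-maximum | yes inhabited =
          let s , cofinal-s = cofinalSequence I⊆B I-downClosed inhabited
                                (noMaximum⇒unbounded I⊆B no-maximum)
          in countable-⊆ cofinal-s
               (countable-⋃ (λ n → _≤ proj₁ (s n)) λ n → ⌈⌉-countable (below-countable (proj₂ (s n))))

        branchPoint-downCountable : ∀ b → B b → IsCountable (_< b)
        branchPoint-downCountable = <-wfInduction (λ b → B b → IsCountable (_< b)) λ b ih Bb →
          let below-B : ∀ {x} → x < b → B x
              below-B x<b = branch-downClosed (proj₁ x<b) Bb
          in downClosed-countable below-B ≤-<-trans λ {x} x<b → ih x x<b (below-B x<b)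

        branch-countable : IsCountable B
        branch-countable = downClosed-countable id branch-downClosed λ {x} → branchPoint-downCountable x

corollary4p6 : ∀ {ℓ} → ExcludedMiddle ℓ → (T : OrderTree ℓ) → (G : TGraph T) →
    TGraph.FiniteAdhesion G →
    (B : OrderTree.Carrier T → Set ℓ) → IsBranch T B → Countable T B
corollary4p6 em T G adhesion B B-branch = branch-countable T em B-branch G adhesion
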